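{- For every $n\ge0$, $\#\mathrm{Av}_n([1243],[1324],[1342])=\#\mathrm{Av}_n([1243],[1342],[1423])$. Moreover, for $n\ge4$, $\#\mathrm{Av}_n([1243],[1324],[1342])=3$.
   Context: For a linear permutation $\pi=\pi_1\ldots\pi_n$ of $[n]$, the cyclic permutation $[\pi]$ is the set of all rotations of $\pi$. A linear permutation $\sigma$ contains $\pi$ if some subsequence of $\sigma$ is order isomorphic to $\pi$ (same relative order). A cyclic permutation $[\sigma]$ contains $[\pi]$ if some rotation of $\sigma$ contains $\pi$; otherwise it avoids $[\pi]$. For a set of cyclic patterns $[\Pi]$, $\mathrm{Av}_n[\Pi]$ denotes the set of cyclic permutations of length $n$ avoiding every pattern in $[\Pi]$. -}

module Defs where

open import Data.Nat using (ℕ; _<_; _≤_)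
open import Data.List using (List; []; _∷_; length; drop; take; _++_; upTo; lookup)
open import Data.List.Relation.Binary.Permutation.Propositional using (_↭_)
open import Data.List.Relation.Binary.Sublist.Propositional using (_⊆_)
open import Data.List.Membership.Propositional using (_∈_)
open import Data.List.Relation.Unary.All using (All)
open import Data.List.Relation.Unary.AllPairs using (AllPairs)
open import Data.Fin using (Fin)
open import Data.Product using (Σ; ∃; ∃-syntax; _×_)
open import Relation.Binary.PropositionalEquality using (_≡_; subst)
open import Relation.Nullary using (¬_)
open import Function.Bundles using (_⇔_)

IsPerm : ℕ → List ℕ → Set
IsPerm n σ = σ ↭ upTo n

OrderIso : List ℕ → List ℕ → Set
OrderIso τ π =
  Σ (length τ ≡ length π) λ eq →
    ∀ (i j : Fin (length τ)) →
      (lookup τ i < lookup τ j) ⇔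
      (lookup π (subst Fin eq i) < lookup π (subst Fin eq j))

Contains : List ℕ → List ℕ → Set
Contains σ π = ∃[ τ ] (τ ⊆ σ × OrderIso τ π)

rotate : ℕ → List ℕ → List ℕ
rotate k σ = drop k σ ++ take k σ

-- τ is a rotation of σ, i.e. [σ] = [τ] as cyclic permutations.
RotEq : List ℕ → List ℕ → Set
RotEq σ τ = ∃[ k ] (k ≤ length σ × rotate k σ ≡ τ)

CycContains : List ℕ → List ℕ → Set
CycContains σ π = ∃[ k ] (k ≤ length σ × Contains (rotate k σ) π)

CycAvoidsAll : List (List ℕ) → List ℕ → Set
CycAvoidsAll Π σ = All (λ π → ¬ CycContains σ π) Π

-- #Av_n[Π] = k : the number of rotation classes of permutations of length n
-- avoiding every pattern of Π is k.
NumAv : List (List ℕ) → ℕ → ℕ → Set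
NumAv Π n k =
  ∃[ L ] ( length L ≡ k
         × All (λ σ → IsPerm n σ × CycAvoidsAll Π σ) L
         × AllPairs (λ σ τ → ¬ RotEq σ τ) L
         × (∀ σ → IsPerm n σ → CycAvoidsAll Π σ → ∃[ ρ ] (ρ ∈ L × RotEq ρ σ)))

p1243 p1324 p1342 p1423 : List ℕ
p1243 = 1 ∷ 2 ∷ 4 ∷ 3 ∷ []
p1324 = 1 ∷ 3 ∷ 2 ∷ 4 ∷ []
p1342 = 1 ∷ 3 ∷ 4 ∷ 2 ∷ []
p1423 = 1 ∷ 4 ∷ 2 ∷ 3 ∷ []

module Submission where

-- Rotate σ so that its minimum 0 comes first, σ ~ 0 ∷ τ.  The patterns 1243 and 1342, together
-- with 1324 (first family) or 1423 (second family), occurring with their 1 at this 0 force τ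
-- to avoid 132, 231 and 213 (resp. 312), so τ is a decreasing run followed by an increasing run
-- lying below it (resp. above it).  A wrap-around occurrence of 1243 (resp. 1342) forbids both
-- runs from having two elements, which leaves the classes of the increasing and the decreasing
-- permutation and one more: 0 (n-1) 1 2 … (n-2) (resp. 0 (n-2) … 1 (n-1)).  That these three
-- avoid the patterns is read off the comparison signatures of their 4-element subsequences,
-- and for n ≥ 4 they are pairwise separated by the patterns 1432, 1423 and 1324 (for n ≤ 3
-- some of them coincide).

open import Defs
open import Data.Bool using (Bool; true; false; T; not)
open import Data.Bool.ListAction using (all)
open import Data.Bool.Properties using (T-∧)
open import Data.Empty using (⊥-elim)
open import Data.Fin as Fin using (Fin; #_)
open import Data.List using (List; []; _∷_; [_]; _++_; length; take; drop; map; lookup; upTo; applyUpTo; applyDownFrom)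
open import Data.List.Membership.Propositional using (_∈_)
open import Data.List.Membership.Propositional.Properties using (∈-∃++)
open import Data.List.Properties using (∷-injective; ∷ʳ-injective; ++-assoc; ++-identityʳ; ++-conicalˡ; ++-conicalʳ; length-++; map-cong; take++drop≡id; applyUpTo-∷ʳ; reverse-applyUpTo)
open import Data.List.Relation.Binary.Equality.Propositional using (≋⇒≡)
open import Data.List.Relation.Binary.Permutation.Propositional using (_↭_; prep; ↭-refl; ↭-sym; ↭-trans; ↭-reflexive; ↭⇒↭ₛ; ↭⇒↭ₛ′)
open import Data.List.Relation.Binary.Permutation.Propositional.Properties using (↭-reverse; ∷↭∷ʳ; ++⁺ʳ; ++-comm; ∈-resp-↭; drop-∷; ↭-length; ↭-empty-inv)
open import Data.List.Relation.Binary.Sublist.Propositional using (_⊆_; []; _∷_; _∷ʳ_; from∈)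
open import Data.List.Relation.Binary.Sublist.Propositional.Properties using (++⁺; ++⁺ˡ; All-resp-⊆; length-mono-≤; []⊆-universal)
open import Data.List.Relation.Unary.All as All using (All; []; _∷_)
open import Data.List.Relation.Unary.All.Properties as AllP using (all⁺)
open import Data.List.Relation.Unary.AllPairs as AP using (AllPairs; []; _∷_)
import Data.List.Relation.Unary.AllPairs.Properties as APP
open import Data.List.Relation.Unary.Any using (Any; here; there)
open import Data.List.Relation.Unary.Sorted.TotalOrder using (Sorted)
import Data.List.Relation.Unary.Sorted.TotalOrder.Properties as SortedP
open import Data.List.Relation.Unary.Unique.Propositional using (Unique)
open import Data.List.Relation.Unary.Unique.Propositional.Properties using (upTo⁺)
open import Data.Nat using (ℕ; zero; suc; _+_; _≤_; _<_; _>_; _<ᵇ_; z≤n; s≤s; z<s; s<s)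
open import Data.Nat.Properties using (<-cmp; <-irrefl; <-asym; <-trans; <-≤-trans; <⇒≤; <⇒≯; <⇒≱; m≤m+n; m≤n+m; n<1+n; n≢0⇒n>0; +-monoˡ-<; ≤-totalOrder; <ᵇ-reflects-<; <ᵇ⇒<; <⇒<ᵇ)
open import Data.Product using (∃-syntax; ∃₂; _×_; _,_; proj₁; proj₂)
open import Data.Sum using (_⊎_; inj₁; inj₂)
open import Function.Base using (_∘_; id)
open import Function.Bundles using (_⇔_; mk⇔; Equivalence)
open import Relation.Binary.Bundles using (TotalOrder)
import Relation.Binary.Construct.Flip.EqAndOrd as Flip
open import Relation.Binary.Core using (_Preserves_⟶_)
open import Relation.Binary.Definitions using (tri<; tri≈; tri>)
open import Relation.Binary.PropositionalEquality using (_≡_; _≢_; refl; sym; trans; cong; cong₂; subst; subst₂; ≢-sym; isEquivalence; setoid)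
open import Data.List.Relation.Binary.Permutation.Setoid.Properties (setoid ℕ) using (Unique-resp-↭)
open import Relation.Nullary using (¬_)
open import Relation.Nullary.Reflects using (Reflects; of; det; fromEquivalence)

pattern quad w x y z = w ∷ x ∷ y ∷ z ∷ []

AllPairs-resp-⊆ : ∀ {R : ℕ → ℕ → Set} {xs ys} → xs ⊆ ys → AllPairs R ys → AllPairs R xs
AllPairs-resp-⊆ []          _            = []
AllPairs-resp-⊆ (_ ∷ʳ xs⊆)  (_ ∷ ys)     = AllPairs-resp-⊆ xs⊆ ys
AllPairs-resp-⊆ (refl ∷ xs⊆) (y ∷ ys)    = All-resp-⊆ xs⊆ y ∷ AllPairs-resp-⊆ xs⊆ ys

⊆-++-split : ∀ (xs ys : List ℕ) {q} → q ⊆ xs ++ ys →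
             ∃₂ λ q₁ q₂ → q ≡ q₁ ++ q₂ × q₁ ⊆ xs × q₂ ⊆ ys
⊆-++-split []       ys q⊆ys         = [] , _ , refl , [] , q⊆ys
⊆-++-split (x ∷ xs) ys (.x ∷ʳ q⊆)   with ⊆-++-split xs ys q⊆
... | q₁ , q₂ , refl , q₁⊆ , q₂⊆ = q₁ , q₂ , refl , x ∷ʳ q₁⊆ , q₂⊆
⊆-++-split (x ∷ xs) ys (refl ∷ q⊆) with ⊆-++-split xs ys q⊆
... | q₁ , q₂ , refl , q₁⊆ , q₂⊆ = x ∷ q₁ , q₂ , refl , refl ∷ q₁⊆ , q₂⊆

++-⊆-cut : ∀ (q₁ q₂ σ : List ℕ) → q₁ ++ q₂ ⊆ σ →
           ∃[ k ] (k ≤ length σ × q₁ ⊆ take k σ × q₂ ⊆ drop k σ)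
++-⊆-cut []       q₂ σ       q⊆         = 0 , z≤n , [] , q⊆
++-⊆-cut (x ∷ q₁) q₂ (y ∷ σ) (.y ∷ʳ q⊆) with ++-⊆-cut (x ∷ q₁) q₂ σ q⊆
... | k , k≤ , q₁⊆ , q₂⊆ = suc k , s≤s k≤ , y ∷ʳ q₁⊆ , q₂⊆
++-⊆-cut (x ∷ q₁) q₂ (y ∷ σ) (x≡y ∷ q⊆) with ++-⊆-cut q₁ q₂ σ q⊆
... | k , k≤ , q₁⊆ , q₂⊆ = suc k , s≤s k≤ , x≡y ∷ q₁⊆ , q₂⊆

++-≡-++-overlap : ∀ (a b c d : List ℕ) → a ++ b ≡ c ++ d →
  (∃[ m ] (a ≡ c ++ m × d ≡ m ++ b)) ⊎ (∃[ m ] (c ≡ a ++ m × b ≡ m ++ d))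
++-≡-++-overlap []      b c       d eq = inj₂ (c , refl , eq)
++-≡-++-overlap (x ∷ a) b []      d eq = inj₁ (x ∷ a , refl , sym eq)
++-≡-++-overlap (x ∷ a) b (y ∷ c) d eq with ∷-injective eq
... | refl , eq′ with ++-≡-++-overlap a b c d eq′
... | inj₁ (m , refl , d≡) = inj₁ (m , refl , d≡)
... | inj₂ (m , refl , b≡) = inj₂ (m , refl , b≡)

drop-length-++ : ∀ (xs ys : List ℕ) → drop (length xs) (xs ++ ys) ≡ ys
drop-length-++ []       ys = refl
drop-length-++ (x ∷ xs) ys = drop-length-++ xs ys

take-length-++ : ∀ (xs ys : List ℕ) → take (length xs) (xs ++ ys) ≡ xs
take-length-++ []       ys = refl
take-length-++ (x ∷ xs) ys = cong (x ∷_) (take-length-++ xs ys)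

↗↭↗⇒≡ : ∀ {xs ys : List ℕ} → AllPairs _<_ xs → AllPairs _<_ ys → xs ↭ ys → xs ≡ ys
↗↭↗⇒≡ xs↗ ys↗ xs↭ys =
  ≋⇒≡ (SortedP.↗↭↗⇒≋ ≤-totalOrder (sorted xs↗) (sorted ys↗) (↭⇒↭ₛ′ isEquivalence xs↭ys))
  where
  sorted : ∀ {zs} → AllPairs _<_ zs → Sorted ≤-totalOrder zs
  sorted = SortedP.AllPairs⇒Sorted ≤-totalOrder ∘ AP.map <⇒≤

↘↭↘⇒≡ : ∀ {xs ys : List ℕ} → AllPairs _>_ xs → AllPairs _>_ ys → xs ↭ ys → xs ≡ ys
↘↭↘⇒≡ xs↘ ys↘ xs↭ys =
  ≋⇒≡ (SortedP.↗↭↗⇒≋ ≥-totalOrder (sorted xs↘) (sorted ys↘) (↭⇒↭ₛ′ isEquivalence xs↭ys))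
  where
  ≥-totalOrder : TotalOrder _ _ _
  ≥-totalOrder = Flip.totalOrder ≤-totalOrder
  sorted : ∀ {zs} → AllPairs _>_ zs → Sorted ≥-totalOrder zs
  sorted = SortedP.AllPairs⇒Sorted ≥-totalOrder ∘ AP.map <⇒≤

All<∧All>⇒[] : ∀ {y zs} → All (y <_) zs → All (_< y) zs → zs ≡ []
All<∧All>⇒[] []          []          = refl
All<∧All>⇒[] (y<z ∷ _)   (z<y ∷ _)   = ⊥-elim (<-asym y<z z<y)

RotEq-++ : ∀ xs ys → RotEq (xs ++ ys) (ys ++ xs)
RotEq-++ xs ys = length xs , subst (length xs ≤_) (sym (length-++ xs)) (m≤m+n _ _) ,
                 cong₂ _++_ (drop-length-++ xs ys) (take-length-++ xs ys)

-- A cyclic occurrence of π in σ: the subsequence q₂ ++ q₁ of σ, read from q₁ round to q₂.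
CycEmbedding : List ℕ → List ℕ → Set
CycEmbedding σ π = ∃₂ λ q₁ q₂ → q₂ ++ q₁ ⊆ σ × OrderIso (q₁ ++ q₂) π

CycContains⇒CycEmbedding : ∀ {σ π} → CycContains σ π → CycEmbedding σ π
CycContains⇒CycEmbedding {σ} (k , _ , τ , τ⊆ , iso)
  with ⊆-++-split (drop k σ) (take k σ) τ⊆
... | q₁ , q₂ , refl , q₁⊆ , q₂⊆ =
  q₁ , q₂ , subst (q₂ ++ q₁ ⊆_) (take++drop≡id k σ) (++⁺ q₂⊆ q₁⊆) , iso

CycEmbedding⇒CycContains : ∀ {σ π} → CycEmbedding σ π → CycContains σ π
CycEmbedding⇒CycContains {σ} (q₁ , q₂ , q⊆ , iso) with ++-⊆-cut q₂ q₁ σ q⊆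
... | k , k≤ , q₂⊆ , q₁⊆ = k , k≤ , q₁ ++ q₂ , ++⁺ q₁⊆ q₂⊆ , iso

CycEmbedding-++-comm : ∀ xs ys {π} → CycEmbedding (xs ++ ys) π → CycEmbedding (ys ++ xs) π
CycEmbedding-++-comm xs ys {π} (q₁ , q₂ , q⊆ , iso) with ⊆-++-split xs ys q⊆
... | r₁ , r₂ , eq , r₁⊆ , r₂⊆ with ++-≡-++-overlap r₁ r₂ q₂ q₁ (sym eq)
... | inj₁ (m , refl , refl) =
  m , r₂ ++ q₂ , subst (_⊆ (ys ++ xs)) (sym (++-assoc r₂ q₂ m)) (++⁺ r₂⊆ r₁⊆) ,
  subst (λ l → OrderIso l π) (++-assoc m r₂ q₂) iso
... | inj₂ (m , refl , refl) =
  q₁ ++ r₁ , m , subst (_⊆ (ys ++ xs)) (++-assoc m q₁ r₁) (++⁺ r₂⊆ r₁⊆) ,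
  subst (λ l → OrderIso l π) (sym (++-assoc q₁ r₁ m)) iso

CycEmbedding-resp-RotEq : ∀ {ρ σ π} → RotEq ρ σ → CycEmbedding ρ π → CycEmbedding σ π
CycEmbedding-resp-RotEq {ρ} {π = π} (k , _ , refl) e =
  CycEmbedding-++-comm (take k ρ) (drop k ρ) {π}
    (subst (λ l → CycEmbedding l π) (sym (take++drop≡id k ρ)) e)

CycEmbedding-resp-RotEq⁻ : ∀ {ρ σ π} → RotEq ρ σ → CycEmbedding σ π → CycEmbedding ρ π
CycEmbedding-resp-RotEq⁻ {ρ} {π = π} (k , _ , refl) e =
  subst (λ l → CycEmbedding l π) (take++drop≡id k ρ)
    (CycEmbedding-++-comm (drop k ρ) (take k ρ) {π} e)

Contains⇒CycEmbedding : ∀ {σ π} → Contains σ π → CycEmbedding σ π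
Contains⇒CycEmbedding {π = π} (τ , τ⊆ , iso) =
  τ , [] , τ⊆ , subst (λ l → OrderIso l π) (sym (++-identityʳ τ)) iso

Avoids : List (List ℕ) → List ℕ → Set
Avoids Π σ = All (λ π → ¬ CycEmbedding σ π) Π

CycAvoidsAll⇒Avoids : ∀ {Π σ} → CycAvoidsAll Π σ → Avoids Π σ
CycAvoidsAll⇒Avoids = All.map (λ {π} ¬c e → ¬c (CycEmbedding⇒CycContains {π = π} e))

Avoids⇒CycAvoidsAll : ∀ {Π σ} → Avoids Π σ → CycAvoidsAll Π σ
Avoids⇒CycAvoidsAll = All.map (λ {π} ¬e c → ¬e (CycContains⇒CycEmbedding {π = π} c))

Avoids-++-comm : ∀ {Π} xs ys → Avoids Π (xs ++ ys) → Avoids Π (ys ++ xs)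
Avoids-++-comm xs ys = All.map (λ {π} ¬e e → ¬e (CycEmbedding-++-comm ys xs {π} e))

Avoids-resp-RotEq⁻ : ∀ {Π ρ σ} → RotEq ρ σ → Avoids Π σ → Avoids Π ρ
Avoids-resp-RotEq⁻ r = All.map (λ {π} ¬e e → ¬e (CycEmbedding-resp-RotEq {π = π} r e))

¬RotEq-separated : ∀ {ρ ρ′ π} → ¬ CycEmbedding ρ π → CycEmbedding ρ′ π → ¬ RotEq ρ ρ′
¬RotEq-separated {π = π} ¬emb emb rot = ¬emb (CycEmbedding-resp-RotEq⁻ {π = π} rot emb)

lookup-map₄ : ∀ (h : ℕ → ℕ) {a b c d} (i : Fin 4) →
              lookup (map h (quad a b c d)) i ≡ h (lookup (quad a b c d) i)
lookup-map₄ h Fin.zero                               = refl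
lookup-map₄ h (Fin.suc Fin.zero)                     = refl
lookup-map₄ h (Fin.suc (Fin.suc Fin.zero))           = refl
lookup-map₄ h (Fin.suc (Fin.suc (Fin.suc Fin.zero))) = refl

strictMono⇒⇔ : ∀ {g : ℕ → ℕ} → g Preserves _<_ ⟶ _<_ → ∀ x y → (g x < g y ⇔ x < y)
strictMono⇒⇔ {g} mono x y = mk⇔ reflect mono
  where
  reflect : g x < g y → x < y
  reflect gx<gy with <-cmp x y
  ... | tri< x<y _ _ = x<y
  ... | tri≈ _ refl _ = ⊥-elim (<-irrefl refl gx<gy)
  ... | tri> _ _ y<x = ⊥-elim (<-asym gx<gy (mono y<x))

-- Patterns take the values 1,…,4, so the pattern value suc r is matched by g r.
OrderIso-relabel : ∀ {g : ℕ → ℕ} → g Preserves _<_ ⟶ _<_ → ∀ {a b c d} →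
                   OrderIso (map g (quad a b c d)) (map suc (quad a b c d))
OrderIso-relabel {g} mono {a} {b} {c} {d} = refl , λ i j →
  subst₂ (λ u v → (u < v) ⇔ (lookup (map suc q) i < lookup (map suc q) j))
    (sym (lookup-map₄ g i)) (sym (lookup-map₄ g j))
    (subst₂ (λ u v → (g (lookup q i) < g (lookup q j)) ⇔ (u < v))
      (sym (lookup-map₄ suc i)) (sym (lookup-map₄ suc j))
      (suc-⇔ (strictMono⇒⇔ mono (lookup q i) (lookup q j))))
  where
  q : List ℕ
  q = quad a b c d
  suc-⇔ : ∀ {P : Set} {m n} → (P ⇔ m < n) → (P ⇔ suc m < suc n)
  suc-⇔ e = mk⇔ (λ p → s<s (Equivalence.to e p)) (λ { (s<s m<n) → Equivalence.from e m<n })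

-- The chain v₀ < v₁ < v₂ < v₃, continued past v₃ only to be strictly increasing on all of ℕ.
chain : ℕ → ℕ → ℕ → ℕ → ℕ → ℕ
chain v₀ v₁ v₂ v₃ 0                   = v₀
chain v₀ v₁ v₂ v₃ 1                   = v₁
chain v₀ v₁ v₂ v₃ 2                   = v₂
chain v₀ v₁ v₂ v₃ (suc (suc (suc k))) = k + v₃

chain-mono : ∀ {v₀ v₁ v₂ v₃} → v₀ < v₁ → v₁ < v₂ → v₂ < v₃ →
             chain v₀ v₁ v₂ v₃ Preserves _<_ ⟶ _<_
chain-mono v₀<v₁ v₁<v₂ v₂<v₃ {0} {1} _ = v₀<v₁
chain-mono v₀<v₁ v₁<v₂ v₂<v₃ {0} {2} _ = <-trans v₀<v₁ v₁<v₂
chain-mono v₀<v₁ v₁<v₂ v₂<v₃ {0} {suc (suc (suc l))} _ =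
  <-≤-trans (<-trans v₀<v₁ (<-trans v₁<v₂ v₂<v₃)) (m≤n+m _ l)
chain-mono v₀<v₁ v₁<v₂ v₂<v₃ {1} {2} _ = v₁<v₂
chain-mono v₀<v₁ v₁<v₂ v₂<v₃ {1} {suc (suc (suc l))} _ = <-≤-trans (<-trans v₁<v₂ v₂<v₃) (m≤n+m _ l)
chain-mono v₀<v₁ v₁<v₂ v₂<v₃ {2} {suc (suc (suc l))} _ = <-≤-trans v₂<v₃ (m≤n+m _ l)
chain-mono _ _ _ {1} {1} (s<s ())
chain-mono _ _ _ {2} {1} (s<s ())
chain-mono _ _ _ {2} {2} (s<s (s<s ()))
chain-mono v₀<v₁ v₁<v₂ v₂<v₃ {suc (suc (suc k))} {suc (suc (suc l))} (s<s (s<s (s<s k<l))) =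
  +-monoˡ-< _ k<l

Contains-chain : ∀ {σ v₀ v₁ v₂ v₃ a b c d} → v₀ < v₁ → v₁ < v₂ → v₂ < v₃ →
                 map (chain v₀ v₁ v₂ v₃) (quad a b c d) ⊆ σ →
                 Contains σ (map suc (quad a b c d))
Contains-chain v₀<v₁ v₁<v₂ v₂<v₃ τ⊆ = _ , τ⊆ , OrderIso-relabel (chain-mono v₀<v₁ v₁<v₂ v₂<v₃)

increasingPairs : List (Fin 4 × Fin 4)
increasingPairs =
  (# 0 , # 1) ∷ (# 0 , # 2) ∷ (# 0 , # 3) ∷ (# 1 , # 2) ∷ (# 1 , # 3) ∷ (# 2 , # 3) ∷ []

-- The order type of a quadruple as its six comparison outcomes; [] on all other lists.
signature : List ℕ → List Bool
signature τ@(quad _ _ _ _) = map (λ (i , j) → lookup τ i <ᵇ lookup τ j) increasingPairs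
signature _               = []

signature-quad : ∀ {w x y z b₁ b₂ b₃ b₄ b₅ b₆} →
  Reflects (w < x) b₁ → Reflects (w < y) b₂ → Reflects (w < z) b₃ →
  Reflects (x < y) b₄ → Reflects (x < z) b₅ → Reflects (y < z) b₆ →
  signature (quad w x y z) ≡ b₁ ∷ b₂ ∷ b₃ ∷ b₄ ∷ b₅ ∷ b₆ ∷ []
signature-quad r₁ r₂ r₃ r₄ r₅ r₆ =
  cong₂ _∷_ (<ᵇ≡ r₁) (cong₂ _∷_ (<ᵇ≡ r₂) (cong₂ _∷_ (<ᵇ≡ r₃)
    (cong₂ _∷_ (<ᵇ≡ r₄) (cong₂ _∷_ (<ᵇ≡ r₅) (cong₂ _∷_ (<ᵇ≡ r₆) refl)))))
  where
  <ᵇ≡ : ∀ {m n b} → Reflects (m < n) b → (m <ᵇ n) ≡ b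
  <ᵇ≡ {m} {n} = det (<ᵇ-reflects-< m n)

⇔⇒<ᵇ≡ : ∀ {m n p q} → (m < n ⇔ p < q) → (m <ᵇ n) ≡ (p <ᵇ q)
⇔⇒<ᵇ≡ {m} {n} {p} {q} e = det (<ᵇ-reflects-< m n)
  (fromEquivalence (Equivalence.from e ∘ <ᵇ⇒< p q) (<⇒<ᵇ ∘ Equivalence.to e))

OrderIso⇒signature≡ : ∀ {w x y z a b c d} → OrderIso (quad w x y z) (quad a b c d) →
                       signature (quad w x y z) ≡ signature (quad a b c d)
OrderIso⇒signature≡ (refl , iso) = map-cong (λ (i , j) → ⇔⇒<ᵇ≡ (iso i j)) increasingPairs

holds : ∀ {m n} → m < n → Reflects (m < n) true
holds = of

fails : ∀ {m n} → n < m → Reflects (m < n) false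
fails n<m = of (<⇒≯ n<m)

signature-↗ : ∀ {w x y z} → AllPairs _<_ (quad w x y z) →
              signature (quad w x y z) ≡ true ∷ true ∷ true ∷ true ∷ true ∷ true ∷ []
signature-↗ ((w<x ∷ w<y ∷ w<z ∷ []) ∷ (x<y ∷ x<z ∷ []) ∷ (y<z ∷ []) ∷ [] ∷ []) =
  signature-quad (holds w<x) (holds w<y) (holds w<z) (holds x<y) (holds x<z) (holds y<z)

signature-↘ : ∀ {w x y z} → AllPairs _>_ (quad w x y z) →
              signature (quad w x y z) ≡ false ∷ false ∷ false ∷ false ∷ false ∷ false ∷ []
signature-↘ ((w>x ∷ w>y ∷ w>z ∷ []) ∷ (x>y ∷ x>z ∷ []) ∷ (y>z ∷ []) ∷ [] ∷ []) =
  signature-quad (fails w>x) (fails w>y) (fails w>z) (fails x>y) (fails x>z) (fails y>z)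

OrderIso-rotate₁ : ∀ {w x y z a b c d} → OrderIso (quad w x y z) (quad a b c d) →
                   OrderIso (quad x y z w) (quad b c d a)
OrderIso-rotate₁ {w} {x} {y} {z} {a} {b} {c} {d} (refl , iso) = refl , λ i j →
  subst₂ (λ u v → (u < v) ⇔ (lookup (quad b c d a) i < lookup (quad b c d a) j))
    (sym (lookup-rotate₁ i)) (sym (lookup-rotate₁ j))
    (subst₂ (λ u v → (lookup (quad w x y z) (next i) < lookup (quad w x y z) (next j)) ⇔ (u < v))
      (sym (lookup-rotate₁ i)) (sym (lookup-rotate₁ j))
      (iso (next i) (next j)))
  where
  next : Fin 4 → Fin 4
  next Fin.zero                               = # 1
  next (Fin.suc Fin.zero)                     = # 2
  next (Fin.suc (Fin.suc Fin.zero))           = # 3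
  next (Fin.suc (Fin.suc (Fin.suc Fin.zero))) = # 0
  lookup-rotate₁ : ∀ {v₀ v₁ v₂ v₃ : ℕ} (i : Fin 4) →
                   lookup (quad v₁ v₂ v₃ v₀) i ≡ lookup (quad v₀ v₁ v₂ v₃) (next i)
  lookup-rotate₁ Fin.zero                               = refl
  lookup-rotate₁ (Fin.suc Fin.zero)                     = refl
  lookup-rotate₁ (Fin.suc (Fin.suc Fin.zero))           = refl
  lookup-rotate₁ (Fin.suc (Fin.suc (Fin.suc Fin.zero))) = refl

rotations : List ℕ → List (List ℕ)
rotations π = map (λ k → rotate k π) (upTo (length π))

length≡4⇒quad : ∀ (τ : List ℕ) → length τ ≡ 4 → ∃[ w ] ∃[ x ] ∃[ y ] ∃[ z ] (τ ≡ quad w x y z)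
length≡4⇒quad (quad w x y z) refl = w , x , y , z , refl

CycEmbedding⇒Contains-rotation : ∀ {ρ a b c d} → CycEmbedding ρ (quad a b c d) →
                                 Any (Contains ρ) (rotations (quad a b c d))
CycEmbedding⇒Contains-rotation (q₁ , q₂ , q⊆ , iso) with length≡4⇒quad (q₁ ++ q₂) (proj₁ iso)
... | _ , _ , _ , _ , eq = rotationAt q₁ q₂ eq q⊆ iso
  where
  rotationAt : ∀ {ρ w x y z a b c d} q₁ q₂ → q₁ ++ q₂ ≡ quad w x y z → q₂ ++ q₁ ⊆ ρ →
               OrderIso (q₁ ++ q₂) (quad a b c d) → Any (Contains ρ) (rotations (quad a b c d))
  rotationAt []               _ refl q⊆ iso = here (_ , q⊆ , iso)
  rotationAt (_ ∷ [])         _ refl q⊆ iso = there (here (_ , q⊆ , OrderIso-rotate₁ iso))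
  rotationAt (_ ∷ _ ∷ [])     _ refl q⊆ iso =
    there (there (here (_ , q⊆ , OrderIso-rotate₁ (OrderIso-rotate₁ iso))))
  rotationAt (_ ∷ _ ∷ _ ∷ []) _ refl q⊆ iso =
    there (there (there (here (_ , q⊆ ,
      OrderIso-rotate₁ (OrderIso-rotate₁ (OrderIso-rotate₁ iso))))))
  rotationAt (quad _ _ _ _)   _ refl q⊆ iso = here (_ , q⊆ , iso)

Signatures : Set
Signatures = List Bool → Bool

QuadruplesIn : Signatures → List ℕ → Set
QuadruplesIn S ρ = ∀ {w x y z} → quad w x y z ⊆ ρ → S (signature (quad w x y z)) ≡ true

QuadruplesIn-short : ∀ S {ρ} → length ρ < 4 → QuadruplesIn S ρ
QuadruplesIn-short _ ρ<4 q⊆ = ⊥-elim (<⇒≱ ρ<4 (length-mono-≤ q⊆))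

-- False on non-quadruples, so that a successful test certifies that π is a quadruple.
excludes : Signatures → List ℕ → Bool
excludes S π@(quad _ _ _ _) = all (λ r → not (S (signature r))) (rotations π)
excludes S _               = false

Contains⇒signature∈ : ∀ {S ρ a b c d} → QuadruplesIn S ρ → Contains ρ (quad a b c d) →
                      S (signature (quad a b c d)) ≡ true
Contains⇒signature∈ {S} inρ (τ , τ⊆ , iso) with length≡4⇒quad τ (proj₁ iso)
... | _ , _ , _ , _ , refl = trans (cong S (sym (OrderIso⇒signature≡ iso))) (inρ τ⊆)

¬Contains-bySignature : ∀ {S ρ a b c d} → QuadruplesIn S ρ →
                        T (not (S (signature (quad a b c d)))) → ¬ Contains ρ (quad a b c d)
¬Contains-bySignature {S} inρ excluded c = subst (T ∘ not) (Contains⇒signature∈ {S} inρ c) excluded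

¬CycEmbedding-bySignatures : ∀ {ρ} S π → QuadruplesIn S ρ → T (excludes S π) → ¬ CycEmbedding ρ π
¬CycEmbedding-bySignatures S π@(quad _ _ _ _) inρ ok emb
  with all⁺ (λ r → not (S (signature r))) (rotations π) ok | CycEmbedding⇒Contains-rotation emb
... | e ∷ _             | here c                         = ¬Contains-bySignature {S} inρ e c
... | _ ∷ e ∷ _         | there (here c)                 = ¬Contains-bySignature {S} inρ e c
... | _ ∷ _ ∷ e ∷ _     | there (there (here c))         = ¬Contains-bySignature {S} inρ e c
... | _ ∷ _ ∷ _ ∷ e ∷ _ | there (there (there (here c))) = ¬Contains-bySignature {S} inρ e c

Avoids-bySignatures : ∀ {ρ} S Π → QuadruplesIn S ρ → T (all (excludes S) Π) → Avoids Π ρ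
Avoids-bySignatures S []      inρ _  = []
Avoids-bySignatures S (π ∷ Π) inρ ok with Equivalence.to T-∧ ok
... | okπ , okΠ = ¬CycEmbedding-bySignatures S π inρ okπ ∷ Avoids-bySignatures S Π inρ okΠ

ascendingSigs : Signatures
ascendingSigs (true ∷ true ∷ true ∷ true ∷ true ∷ true ∷ []) = true
ascendingSigs _                                                = false

QuadruplesIn-↗ : ∀ {ρ} → AllPairs _<_ ρ → QuadruplesIn ascendingSigs ρ
QuadruplesIn-↗ ρ↗ q⊆ = cong ascendingSigs (signature-↗ (AllPairs-resp-⊆ q⊆ ρ↗))

descendingSigs : Signatures
descendingSigs (false ∷ false ∷ false ∷ false ∷ false ∷ false ∷ []) = true
descendingSigs (true  ∷ true  ∷ true  ∷ false ∷ false ∷ false ∷ []) = true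
descendingSigs _                                                      = false

QuadruplesIn-min∷↘ : ∀ {h L} → All (h <_) L → AllPairs _>_ L → QuadruplesIn descendingSigs (h ∷ L)
QuadruplesIn-min∷↘ h<L L↘ (_ ∷ʳ q⊆) = cong descendingSigs (signature-↘ (AllPairs-resp-⊆ q⊆ L↘))
QuadruplesIn-min∷↘ h<L L↘ (refl ∷ q⊆) with All-resp-⊆ q⊆ h<L | AllPairs-resp-⊆ q⊆ L↘
... | h<x ∷ h<y ∷ h<z ∷ [] | (x>y ∷ x>z ∷ []) ∷ (y>z ∷ []) ∷ [] ∷ [] =
  cong descendingSigs (signature-quad (holds h<x) (holds h<y) (holds h<z)
                                      (fails x>y) (fails x>z) (fails y>z))

minMaxAscendingSigs : Signatures
minMaxAscendingSigs (true  ∷ true  ∷ true  ∷ true  ∷ true  ∷ true ∷ []) = true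
minMaxAscendingSigs (false ∷ false ∷ false ∷ true  ∷ true  ∷ true ∷ []) = true
minMaxAscendingSigs (true  ∷ true  ∷ true  ∷ false ∷ false ∷ true ∷ []) = true
minMaxAscendingSigs _                                                     = false

QuadruplesIn-min∷max∷↗ : ∀ {h m L} → h < m → All (h <_) L → All (_< m) L → AllPairs _<_ L →
                          QuadruplesIn minMaxAscendingSigs (h ∷ m ∷ L)
QuadruplesIn-min∷max∷↗ h<m h<L L<m L↗ (_ ∷ʳ (_ ∷ʳ q⊆)) =
  cong minMaxAscendingSigs (signature-↗ (AllPairs-resp-⊆ q⊆ L↗))
QuadruplesIn-min∷max∷↗ h<m h<L L<m L↗ (_ ∷ʳ (refl ∷ q⊆))
  with All-resp-⊆ q⊆ L<m | AllPairs-resp-⊆ q⊆ L↗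
... | x<m ∷ y<m ∷ z<m ∷ [] | (x<y ∷ x<z ∷ []) ∷ (y<z ∷ []) ∷ [] ∷ [] =
  cong minMaxAscendingSigs (signature-quad (fails x<m) (fails y<m) (fails z<m)
                                           (holds x<y) (holds x<z) (holds y<z))
QuadruplesIn-min∷max∷↗ h<m h<L L<m L↗ (refl ∷ (_ ∷ʳ q⊆))
  with All-resp-⊆ q⊆ h<L | AllPairs-resp-⊆ q⊆ L↗
... | h<x ∷ h<y ∷ h<z ∷ [] | (x<y ∷ x<z ∷ []) ∷ (y<z ∷ []) ∷ [] ∷ [] =
  cong minMaxAscendingSigs (signature-quad (holds h<x) (holds h<y) (holds h<z)
                                           (holds x<y) (holds x<z) (holds y<z))
QuadruplesIn-min∷max∷↗ h<m h<L L<m L↗ (refl ∷ (refl ∷ q⊆))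
  with All-resp-⊆ q⊆ h<L | All-resp-⊆ q⊆ L<m | AllPairs-resp-⊆ q⊆ L↗
... | h<x ∷ h<y ∷ [] | x<m ∷ y<m ∷ [] | (x<y ∷ []) ∷ [] ∷ [] =
  cong minMaxAscendingSigs (signature-quad (holds h<m) (holds h<x) (holds h<y)
                                           (fails x<m) (fails y<m) (holds x<y))

maxMinDescendingSigs : Signatures
maxMinDescendingSigs (false ∷ false ∷ false ∷ false ∷ false ∷ false ∷ []) = true
maxMinDescendingSigs (true  ∷ true  ∷ true  ∷ false ∷ false ∷ false ∷ []) = true
maxMinDescendingSigs (false ∷ false ∷ false ∷ true  ∷ true  ∷ false ∷ []) = true
maxMinDescendingSigs _                                                      = false

QuadruplesIn-max∷min∷↘ : ∀ {h m L} → h < m → All (h <_) L → All (_< m) L → AllPairs _>_ L →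
                          QuadruplesIn maxMinDescendingSigs (m ∷ h ∷ L)
QuadruplesIn-max∷min∷↘ h<m h<L L<m L↘ (_ ∷ʳ (_ ∷ʳ q⊆)) =
  cong maxMinDescendingSigs (signature-↘ (AllPairs-resp-⊆ q⊆ L↘))
QuadruplesIn-max∷min∷↘ h<m h<L L<m L↘ (_ ∷ʳ (refl ∷ q⊆))
  with All-resp-⊆ q⊆ h<L | AllPairs-resp-⊆ q⊆ L↘
... | h<x ∷ h<y ∷ h<z ∷ [] | (x>y ∷ x>z ∷ []) ∷ (y>z ∷ []) ∷ [] ∷ [] =
  cong maxMinDescendingSigs (signature-quad (holds h<x) (holds h<y) (holds h<z)
                                            (fails x>y) (fails x>z) (fails y>z))
QuadruplesIn-max∷min∷↘ h<m h<L L<m L↘ (refl ∷ (_ ∷ʳ q⊆))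
  with All-resp-⊆ q⊆ L<m | AllPairs-resp-⊆ q⊆ L↘
... | x<m ∷ y<m ∷ z<m ∷ [] | (x>y ∷ x>z ∷ []) ∷ (y>z ∷ []) ∷ [] ∷ [] =
  cong maxMinDescendingSigs (signature-quad (fails x<m) (fails y<m) (fails z<m)
                                            (fails x>y) (fails x>z) (fails y>z))
QuadruplesIn-max∷min∷↘ h<m h<L L<m L↘ (refl ∷ (refl ∷ q⊆))
  with All-resp-⊆ q⊆ h<L | All-resp-⊆ q⊆ L<m | AllPairs-resp-⊆ q⊆ L↘
... | h<x ∷ h<y ∷ [] | x<m ∷ y<m ∷ [] | (x>y ∷ []) ∷ [] ∷ [] =
  cong maxMinDescendingSigs (signature-quad (fails h<m) (fails x<m) (fails y<m)
                                            (holds h<x) (holds h<y) (fails x>y))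

ascending : ℕ → List ℕ
ascending = upTo

descending : ℕ → List ℕ
descending zero    = []
descending (suc k) = 0 ∷ applyDownFrom suc k

minMaxAscending : ℕ → List ℕ
minMaxAscending zero          = []
minMaxAscending (suc zero)    = 0 ∷ []
minMaxAscending (suc (suc k)) = 0 ∷ suc k ∷ applyUpTo suc k

minDescendingMax : ℕ → List ℕ
minDescendingMax zero          = []
minDescendingMax (suc zero)    = 0 ∷ []
minDescendingMax (suc (suc k)) = 0 ∷ applyDownFrom suc k ++ [ suc k ]

module Interval (k : ℕ) where
  ↗ : AllPairs _<_ (applyUpTo suc k)
  ↗ = APP.applyUpTo⁺₁ suc k (λ i<j _ → s<s i<j)

  ↗-pos : All (0 <_) (applyUpTo suc k)
  ↗-pos = AllP.applyUpTo⁺₂ suc k (λ _ → z<s)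

  ↗-bound : All (_< suc k) (applyUpTo suc k)
  ↗-bound = AllP.applyUpTo⁺₁ suc k s<s

  ↘ : AllPairs _>_ (applyDownFrom suc k)
  ↘ = APP.applyDownFrom⁺₁ suc k (λ j<i _ → s<s j<i)

  ↘-pos : All (0 <_) (applyDownFrom suc k)
  ↘-pos = AllP.applyDownFrom⁺₂ suc k (λ _ → z<s)

  ↘-bound : All (_< suc k) (applyDownFrom suc k)
  ↘-bound = AllP.applyDownFrom⁺₁ suc k s<s

  ↘↭↗ : applyDownFrom suc k ↭ applyUpTo suc k
  ↘↭↗ = subst (_↭ applyUpTo suc k) (reverse-applyUpTo suc k) (↭-reverse (applyUpTo suc k))

  ↗∷ʳmax : applyUpTo suc k ++ [ suc k ] ≡ applyUpTo suc (suc k)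
  ↗∷ʳmax = applyUpTo-∷ʳ suc k

upTo-↗ : ∀ n → AllPairs _<_ (upTo n)
upTo-↗ n = APP.applyUpTo⁺₁ id n (λ i<j _ → i<j)

ascending-perm : ∀ n → IsPerm n (ascending n)
ascending-perm n = ↭-refl

descending-perm : ∀ n → IsPerm n (descending n)
descending-perm zero    = ↭-refl
descending-perm (suc k) = prep 0 (Interval.↘↭↗ k)

minMaxAscending-perm : ∀ n → IsPerm n (minMaxAscending n)
minMaxAscending-perm zero          = ↭-refl
minMaxAscending-perm (suc zero)    = ↭-refl
minMaxAscending-perm (suc (suc k)) =
  prep 0 (↭-trans (∷↭∷ʳ (suc k) (applyUpTo suc k)) (↭-reflexive (Interval.↗∷ʳmax k)))

minDescendingMax-perm : ∀ n → IsPerm n (minDescendingMax n)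
minDescendingMax-perm zero          = ↭-refl
minDescendingMax-perm (suc zero)    = ↭-refl
minDescendingMax-perm (suc (suc k)) =
  prep 0 (↭-trans (++⁺ʳ [ suc k ] (Interval.↘↭↗ k)) (↭-reflexive (Interval.↗∷ʳmax k)))

ascending-quads : ∀ n → QuadruplesIn ascendingSigs (ascending n)
ascending-quads n = QuadruplesIn-↗ (upTo-↗ n)

descending-quads : ∀ n → QuadruplesIn descendingSigs (descending n)
descending-quads zero    = QuadruplesIn-short descendingSigs z<s
descending-quads (suc k) = QuadruplesIn-min∷↘ (Interval.↘-pos k) (Interval.↘ k)

minMaxAscending-quads : ∀ n → QuadruplesIn minMaxAscendingSigs (minMaxAscending n)
minMaxAscending-quads zero          = QuadruplesIn-short minMaxAscendingSigs z<s
minMaxAscending-quads (suc zero)    = QuadruplesIn-short minMaxAscendingSigs (s<s z<s)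
minMaxAscending-quads (suc (suc k)) = QuadruplesIn-min∷max∷↗ z<s ↗-pos ↗-bound ↗
  where open Interval k

ascending-avoids : ∀ {Π} n → T (all (excludes ascendingSigs) Π) → Avoids Π (ascending n)
ascending-avoids n = Avoids-bySignatures ascendingSigs _ (ascending-quads n)

descending-avoids : ∀ {Π} n → T (all (excludes descendingSigs) Π) → Avoids Π (descending n)
descending-avoids n = Avoids-bySignatures descendingSigs _ (descending-quads n)

minMaxAscending-avoids : ∀ {Π} n → T (all (excludes minMaxAscendingSigs) Π) →
                         Avoids Π (minMaxAscending n)
minMaxAscending-avoids n = Avoids-bySignatures minMaxAscendingSigs _ (minMaxAscending-quads n)

minDescendingMax-avoids : ∀ {Π} n → T (all (excludes maxMinDescendingSigs) Π) →
                          Avoids Π (minDescendingMax n)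
minDescendingMax-avoids zero          = Avoids-bySignatures maxMinDescendingSigs _
                                          (QuadruplesIn-short maxMinDescendingSigs z<s)
minDescendingMax-avoids (suc zero)    = Avoids-bySignatures maxMinDescendingSigs _
                                          (QuadruplesIn-short maxMinDescendingSigs (s<s z<s))
minDescendingMax-avoids (suc (suc k)) ok =
  Avoids-++-comm [ suc k ] (0 ∷ applyDownFrom suc k)
    (Avoids-bySignatures maxMinDescendingSigs _ (QuadruplesIn-max∷min∷↘ z<s ↘-pos ↘-bound ↘) ok)
  where open Interval k

p1432 : List ℕ
p1432 = 1 ∷ 4 ∷ 3 ∷ 2 ∷ []

descending-1432 : ∀ k → CycEmbedding (descending (4 + k)) p1432
descending-1432 k = Contains⇒CycEmbedding
  (Contains-chain z<s (n<1+n _) (n<1+n _) (refl ∷ refl ∷ refl ∷ refl ∷ []⊆-universal _))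

minMaxAscending-1423 : ∀ k → CycEmbedding (minMaxAscending (4 + k)) p1423
minMaxAscending-1423 k = Contains⇒CycEmbedding
  (Contains-chain z<s (s<s z<s) (s<s (s<s z<s)) (refl ∷ refl ∷ refl ∷ refl ∷ []⊆-universal _))

minDescendingMax-1324 : ∀ k → CycEmbedding (minDescendingMax (4 + k)) p1324
minDescendingMax-1324 k = Contains⇒CycEmbedding
  (Contains-chain z<s (n<1+n _) (n<1+n _)
    (refl ∷ refl ∷ refl ∷ ++⁺ˡ (applyDownFrom suc k) (refl ∷ [])))

ascending≁descending : ∀ k → ¬ RotEq (ascending (4 + k)) (descending (4 + k))
ascending≁descending k =
  ¬RotEq-separated (¬CycEmbedding-bySignatures ascendingSigs p1432 (ascending-quads (4 + k)) _)
                   (descending-1432 k)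

ascending3≁descending3 : ¬ RotEq (ascending 3) (descending 3)
ascending3≁descending3 (0 , _ , ())
ascending3≁descending3 (1 , _ , ())
ascending3≁descending3 (2 , _ , ())
ascending3≁descending3 (3 , _ , ())
ascending3≁descending3 (suc (suc (suc (suc _))) , s≤s (s≤s (s≤s ())) , _)

minMaxAscending-small : ∀ n → n < 3 → minMaxAscending n ≡ ascending n
minMaxAscending-small 0 _ = refl
minMaxAscending-small 1 _ = refl
minMaxAscending-small 2 _ = refl
minMaxAscending-small (suc (suc (suc _))) (s<s (s<s (s<s ())))

minDescendingMax-small : ∀ n → n < 3 → minDescendingMax n ≡ ascending n
minDescendingMax-small 0 _ = refl
minDescendingMax-small 1 _ = refl
minDescendingMax-small 2 _ = refl
minDescendingMax-small (suc (suc (suc _))) (s<s (s<s (s<s ())))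

minMaxAscending-separated : ∀ k → ¬ RotEq (ascending (4 + k)) (minMaxAscending (4 + k))
                                × ¬ RotEq (descending (4 + k)) (minMaxAscending (4 + k))
minMaxAscending-separated k =
  ¬RotEq-separated (¬CycEmbedding-bySignatures ascendingSigs p1423 (ascending-quads (4 + k)) _)
                   (minMaxAscending-1423 k) ,
  ¬RotEq-separated (¬CycEmbedding-bySignatures descendingSigs p1423 (descending-quads (4 + k)) _)
                   (minMaxAscending-1423 k)

minDescendingMax-separated : ∀ k → ¬ RotEq (ascending (4 + k)) (minDescendingMax (4 + k))
                                 × ¬ RotEq (descending (4 + k)) (minDescendingMax (4 + k))
minDescendingMax-separated k =
  ¬RotEq-separated (¬CycEmbedding-bySignatures ascendingSigs p1324 (ascending-quads (4 + k)) _)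
                   (minDescendingMax-1324 k) ,
  ¬RotEq-separated (¬CycEmbedding-bySignatures descendingSigs p1324 (descending-quads (4 + k)) _)
                   (minDescendingMax-1324 k)

AscentsPersist : List ℕ → Set
AscentsPersist τ = ∀ {a b c} → a ∷ b ∷ c ∷ [] ⊆ τ → a < b → b < c

DescentsStayBelow : List ℕ → Set
DescentsStayBelow τ = ∀ {a b c} → a ∷ b ∷ c ∷ [] ⊆ τ → b < a → c < a

DescentsStayOutside : List ℕ → Set
DescentsStayOutside τ = ∀ {a b c} → a ∷ b ∷ c ∷ [] ⊆ τ → b < a → c < b ⊎ a < c

ValleyShape : (ℕ → ℕ → Set) → List ℕ → Set
ValleyShape R τ =
  ∃₂ λ D I → τ ≡ D ++ I × AllPairs _>_ D × AllPairs _<_ I × All (λ d → All (R d) I) D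

All-after : ∀ {P : ℕ → Set} {x y} zs → (∀ {z} → x ∷ y ∷ z ∷ [] ⊆ x ∷ y ∷ zs → P z) → All P zs
All-after zs f = All.tabulate (λ z∈zs → f (refl ∷ refl ∷ from∈ z∈zs))

ValleyShape-below-∷ : ∀ x D I → All (x ≢_) (D ++ I) →
  AscentsPersist (x ∷ D ++ I) → DescentsStayBelow (x ∷ D ++ I) →
  AllPairs _>_ D → AllPairs _<_ I → All (λ d → All (d >_) I) D → ValleyShape _>_ (x ∷ D ++ I)
ValleyShape-below-∷ x [] [] _ _ _ _ _ _ = [] , x ∷ [] , refl , [] , [] ∷ [] , []
ValleyShape-below-∷ x [] (y ∷ I) (x≢y ∷ _) _ below [] (y<I ∷ I↗) [] with <-cmp x y
... | tri< x<y _ _ = [] , x ∷ y ∷ I , refl , [] , (x<y ∷ All.map (<-trans x<y) y<I) ∷ y<I ∷ I↗ , []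
... | tri≈ _ x≡y _ = ⊥-elim (x≢y x≡y)
... | tri> _ _ y<x =
  x ∷ [] , y ∷ I , refl , [] ∷ [] , y<I ∷ I↗ , (y<x ∷ All-after I (λ t → below t y<x)) ∷ []
ValleyShape-below-∷ x (y ∷ D) I (x≢y ∷ _) persist below (y>D ∷ D↘) I↗ (y>I ∷ D>I) with <-cmp x y
... | tri≈ _ x≡y _ = ⊥-elim (x≢y x≡y)
... | tri> _ _ y<x =
  x ∷ y ∷ D , I , refl , (y<x ∷ AllP.++⁻ˡ D x>later) ∷ y>D ∷ D↘ , I↗ ,
  AllP.++⁻ʳ D x>later ∷ y>I ∷ D>I
  where
  x>later : All (_< x) (D ++ I)
  x>later = All-after (D ++ I) (λ t → below t y<x)
... | tri< x<y _ _
  with All<∧All>⇒[] (All-after (D ++ I) (λ t → persist t x<y)) (AllP.++⁺ y>D y>I)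
... | D++I≡[] with ++-conicalˡ D I D++I≡[] | ++-conicalʳ D I D++I≡[]
... | refl | refl = [] , x ∷ y ∷ [] , refl , [] , (x<y ∷ []) ∷ [] ∷ [] , []

valleyShape-below : ∀ τ → Unique τ → AscentsPersist τ → DescentsStayBelow τ → ValleyShape _>_ τ
valleyShape-below []      _            _       _     = [] , [] , refl , [] , [] , []
valleyShape-below (x ∷ τ) (x∉τ ∷ τ-unique) persist below
  with valleyShape-below τ τ-unique (λ t → persist (x ∷ʳ t)) (λ t → below (x ∷ʳ t))
... | D , I , refl , D↘ , I↗ , D>I = ValleyShape-below-∷ x D I x∉τ persist below D↘ I↗ D>I

outside⇒above : ∀ {x y zs} → All (λ z → z < y ⊎ x < z) zs → All (y <_) zs → All (x <_) zs
outside⇒above []                     []          = []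
outside⇒above (inj₁ z<y ∷ outside)   (y<z ∷ y<zs) = ⊥-elim (<-asym z<y y<z)
outside⇒above (inj₂ x<z ∷ outside)   (_ ∷ y<zs)   = x<z ∷ outside⇒above outside y<zs

ValleyShape-outside-∷ : ∀ x D I → All (x ≢_) (D ++ I) →
  AscentsPersist (x ∷ D ++ I) → DescentsStayOutside (x ∷ D ++ I) →
  AllPairs _>_ D → AllPairs _<_ I → All (λ d → All (d <_) I) D → ValleyShape _<_ (x ∷ D ++ I)
ValleyShape-outside-∷ x [] [] _ _ _ _ _ _ = [] , x ∷ [] , refl , [] , [] ∷ [] , []
ValleyShape-outside-∷ x [] (y ∷ I) (x≢y ∷ _) _ outside [] (y<I ∷ I↗) [] with <-cmp x y
... | tri< x<y _ _ = [] , x ∷ y ∷ I , refl , [] , (x<y ∷ All.map (<-trans x<y) y<I) ∷ y<I ∷ I↗ , []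
... | tri≈ _ x≡y _ = ⊥-elim (x≢y x≡y)
... | tri> _ _ y<x = x ∷ y ∷ [] , I , refl , (y<x ∷ []) ∷ [] ∷ [] , I↗ , x<I ∷ y<I ∷ []
  where
  x<I : All (x <_) I
  x<I = outside⇒above (All-after I (λ t → outside t y<x)) y<I
ValleyShape-outside-∷ x (y ∷ D) I (x≢y ∷ _) persist outside (y>D ∷ D↘) I↗ (y<I ∷ D<I)
  with <-cmp x y
... | tri≈ _ x≡y _ = ⊥-elim (x≢y x≡y)
... | tri> _ _ y<x =
  x ∷ y ∷ D , I , refl , (y<x ∷ All.map (λ z<y → <-trans z<y y<x) y>D) ∷ y>D ∷ D↘ , I↗ ,
  x<I ∷ y<I ∷ D<I
  where
  x<I : All (x <_) I
  x<I = outside⇒above (AllP.++⁻ʳ D (All-after (D ++ I) (λ t → outside t y<x))) y<I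
... | tri< x<y _ _
  with All<∧All>⇒[] (AllP.++⁻ˡ D (All-after (D ++ I) (λ t → persist t x<y))) y>D
... | refl = [] , x ∷ y ∷ I , refl , [] , (x<y ∷ All.map (<-trans x<y) y<I) ∷ y<I ∷ I↗ , []

valleyShape-outside : ∀ τ → Unique τ → AscentsPersist τ → DescentsStayOutside τ → ValleyShape _<_ τ
valleyShape-outside []      _            _       _       = [] , [] , refl , [] , [] , []
valleyShape-outside (x ∷ τ) (x∉τ ∷ τ-unique) persist outside
  with valleyShape-outside τ τ-unique (λ t → persist (x ∷ʳ t)) (λ t → outside (x ∷ʳ t))
... | D , I , refl , D↘ , I↗ , D<I = ValleyShape-outside-∷ x D I x∉τ persist outside D↘ I↗ D<I

module _ {τ : List ℕ} (τ-pos : All (0 <_) τ) (τ-unique : Unique τ) where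

  private
    occurrence : ∀ {π} → ¬ CycEmbedding (0 ∷ τ) π → ¬ Contains (0 ∷ τ) π
    occurrence {π} ¬emb = ¬emb ∘ Contains⇒CycEmbedding {π = π}

  ascentsPersist : ¬ CycEmbedding (0 ∷ τ) p1243 → ¬ CycEmbedding (0 ∷ τ) p1342 → AscentsPersist τ
  ascentsPersist ¬1243 ¬1342 {a} {b} {c} t a<b
    with All-resp-⊆ t τ-pos | AllPairs-resp-⊆ t τ-unique
  ... | 0<a ∷ _ ∷ 0<c ∷ [] | (_ ∷ a≢c ∷ []) ∷ (b≢c ∷ []) ∷ [] ∷ [] with <-cmp b c
  ... | tri< b<c _ _ = b<c
  ... | tri≈ _ b≡c _ = ⊥-elim (b≢c b≡c)
  ... | tri> _ _ c<b with <-cmp a c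
  ...   | tri< a<c _ _ = ⊥-elim (occurrence ¬1243 (Contains-chain 0<a a<c c<b (refl ∷ t)))
  ...   | tri≈ _ a≡c _ = ⊥-elim (a≢c a≡c)
  ...   | tri> _ _ c<a = ⊥-elim (occurrence ¬1342 (Contains-chain 0<c c<a a<b (refl ∷ t)))

  descentsStayBelow : ¬ CycEmbedding (0 ∷ τ) p1324 → DescentsStayBelow τ
  descentsStayBelow ¬1324 {a} {b} {c} t b<a
    with All-resp-⊆ t τ-pos | AllPairs-resp-⊆ t τ-unique
  ... | _ ∷ 0<b ∷ _ ∷ [] | (_ ∷ a≢c ∷ []) ∷ _ ∷ [] ∷ [] with <-cmp c a
  ... | tri< c<a _ _ = c<a
  ... | tri≈ _ c≡a _ = ⊥-elim (a≢c (sym c≡a))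
  ... | tri> _ _ a<c = ⊥-elim (occurrence ¬1324 (Contains-chain 0<b b<a a<c (refl ∷ t)))

  descentsStayOutside : ¬ CycEmbedding (0 ∷ τ) p1423 → DescentsStayOutside τ
  descentsStayOutside ¬1423 {a} {b} {c} t b<a
    with All-resp-⊆ t τ-pos | AllPairs-resp-⊆ t τ-unique
  ... | _ ∷ 0<b ∷ _ ∷ [] | (_ ∷ a≢c ∷ []) ∷ (b≢c ∷ []) ∷ [] ∷ [] with <-cmp c b
  ... | tri< c<b _ _ = inj₁ c<b
  ... | tri≈ _ c≡b _ = ⊥-elim (b≢c (sym c≡b))
  ... | tri> _ _ b<c with <-cmp c a
  ...   | tri< c<a _ _ = ⊥-elim (occurrence ¬1423 (Contains-chain 0<b b<c c<a (refl ∷ t)))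
  ...   | tri≈ _ c≡a _ = ⊥-elim (a≢c (sym c≡a))
  ...   | tri> _ _ a<c = inj₂ a<c

rotate-min-first : ∀ {n σ} → IsPerm (suc n) σ → ∃[ τ ] (RotEq (0 ∷ τ) σ × IsPerm (suc n) (0 ∷ τ))
rotate-min-first σ↭ with ∈-∃++ (∈-resp-↭ (↭-sym σ↭) (here refl))
... | α , β , refl = β ++ α , RotEq-++ (0 ∷ β) α , ↭-trans (++-comm (0 ∷ β) α) σ↭

IsPerm-0∷⇒positive×unique : ∀ {n τ} → IsPerm (suc n) (0 ∷ τ) → All (0 <_) τ × Unique τ
IsPerm-0∷⇒positive×unique {n} 0∷τ↭ with Unique-resp-↭ (↭⇒↭ₛ (↭-sym 0∷τ↭)) (upTo⁺ (suc n))
... | 0∉τ ∷ τ-unique = All.map (λ 0≢x → n≢0⇒n>0 (≢-sym 0≢x)) 0∉τ , τ-unique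

0∷↗≡ascending : ∀ {n τ} → All (0 <_) τ → AllPairs _<_ τ → IsPerm n (0 ∷ τ) → 0 ∷ τ ≡ ascending n
0∷↗≡ascending {n} τ-pos τ↗ 0∷τ↭ = ↗↭↗⇒≡ (τ-pos ∷ τ↗) (upTo-↗ n) 0∷τ↭

0∷↘≡descending : ∀ {n τ} → AllPairs _>_ τ → IsPerm (suc n) (0 ∷ τ) → 0 ∷ τ ≡ descending (suc n)
0∷↘≡descending {n} τ↘ 0∷τ↭ =
  cong (0 ∷_) (↘↭↘⇒≡ τ↘ (Interval.↘ n) (drop-∷ (↭-trans 0∷τ↭ (↭-sym (descending-perm (suc n))))))

0∷max∷↗≡minMaxAscending : ∀ {n d I} → All (_< d) I → AllPairs _<_ I → IsPerm (suc n) (0 ∷ d ∷ I) →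
                          0 ∷ d ∷ I ≡ minMaxAscending (suc n)
0∷max∷↗≡minMaxAscending {zero} _ _ 0∷d∷I↭ with () ← ↭-length 0∷d∷I↭
0∷max∷↗≡minMaxAscending {suc k} {d} {I} I<d I↗ 0∷d∷I↭
  with ∷ʳ-injective I (applyUpTo suc k) (↗↭↗⇒≡ (↗∷ʳ I↗ I<d) (↗∷ʳ ↗ ↗-bound) I∷ʳd↭)
  where
  open Interval k
  ↗∷ʳ : ∀ {m L} → AllPairs _<_ L → All (_< m) L → AllPairs _<_ (L ++ [ m ])
  ↗∷ʳ L↗ L<m = APP.++⁺ L↗ ([] ∷ []) (All.map (_∷ []) L<m)
  I∷ʳd↭ : I ++ [ d ] ↭ applyUpTo suc k ++ [ suc k ]
  I∷ʳd↭ = ↭-trans (↭-sym (∷↭∷ʳ d I))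
            (↭-trans (drop-∷ (↭-trans 0∷d∷I↭ (↭-sym (minMaxAscending-perm (suc (suc k))))))
              (∷↭∷ʳ (suc k) (applyUpTo suc k)))
... | refl , refl = refl

0∷↘∷ʳmax≡minDescendingMax : ∀ {n d D m} → All (_< m) (d ∷ D) → AllPairs _>_ (d ∷ D) →
                            IsPerm (suc n) (0 ∷ d ∷ D ++ [ m ]) →
                            0 ∷ d ∷ D ++ [ m ] ≡ minDescendingMax (suc n)
0∷↘∷ʳmax≡minDescendingMax {zero} {D = D} _ _ 0∷τ↭
  with () ← trans (sym (↭-length 0∷τ↭)) (cong (suc ∘ suc) (length-++ D))
0∷↘∷ʳmax≡minDescendingMax {suc k} {d} {D} {m} D<m D↘ 0∷τ↭
  with ∷-injective (↘↭↘⇒≡ (D<m ∷ D↘) (↘-bound ∷ ↘) m∷D↭)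
  where
  open Interval k
  m∷D↭ : m ∷ d ∷ D ↭ suc k ∷ applyDownFrom suc k
  m∷D↭ = ↭-trans (∷↭∷ʳ m (d ∷ D))
           (↭-trans (drop-∷ (↭-trans 0∷τ↭ (↭-sym (minDescendingMax-perm (suc (suc k))))))
             (↭-sym (∷↭∷ʳ (suc k) (applyDownFrom suc k))))
... | refl , d∷D≡ = cong (λ L → 0 ∷ L ++ [ suc k ]) d∷D≡

candidates : (ℕ → List ℕ) → ℕ → List (List ℕ)
candidates third n = ascending n ∷ descending n ∷ third n ∷ []

classify-below : ∀ {n} D I → IsPerm (suc n) (0 ∷ D ++ I) → All (0 <_) (D ++ I) →
  ¬ CycEmbedding (0 ∷ D ++ I) p1243 →
  AllPairs _>_ D → AllPairs _<_ I → All (λ d → All (d >_) I) D →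
  (0 ∷ D ++ I) ∈ candidates minMaxAscending (suc n)
classify-below [] I 0∷τ↭ τ-pos _ _ I↗ _ = here (0∷↗≡ascending τ-pos I↗ 0∷τ↭)
classify-below (d ∷ D) [] 0∷τ↭ _ _ D↘ _ D>I =
  there (here (0∷↘≡descending (APP.++⁺ D↘ [] D>I) 0∷τ↭))
classify-below (d ∷ D) (i ∷ []) 0∷τ↭ _ _ D↘ _ D>I =
  there (here (0∷↘≡descending (APP.++⁺ D↘ ([] ∷ []) D>I) 0∷τ↭))
classify-below (d ∷ []) I@(_ ∷ _ ∷ _) 0∷τ↭ _ _ _ I↗ (I<d ∷ []) =
  there (there (here (0∷max∷↗≡minMaxAscending I<d I↗ 0∷τ↭)))
classify-below (d₁ ∷ d₂ ∷ D) (i₁ ∷ i₂ ∷ I) _ _ ¬1243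
               ((d₂<d₁ ∷ _) ∷ _) ((i₁<i₂ ∷ _) ∷ _) (_ ∷ (_ ∷ i₂<d₂ ∷ _) ∷ _) =
  ⊥-elim (¬1243 (i₁ ∷ i₂ ∷ [] , d₁ ∷ d₂ ∷ [] ,
                 0 ∷ʳ (refl ∷ refl ∷ ++⁺ˡ D (refl ∷ refl ∷ []⊆-universal I)) ,
                 OrderIso-relabel (chain-mono i₁<i₂ i₂<d₂ d₂<d₁)))

classify-outside : ∀ {n} D I → IsPerm (suc n) (0 ∷ D ++ I) → All (0 <_) (D ++ I) →
  ¬ CycEmbedding (0 ∷ D ++ I) p1342 →
  AllPairs _>_ D → AllPairs _<_ I → All (λ d → All (d <_) I) D →
  (0 ∷ D ++ I) ∈ candidates minDescendingMax (suc n)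
classify-outside [] I 0∷τ↭ τ-pos _ _ I↗ _ = here (0∷↗≡ascending τ-pos I↗ 0∷τ↭)
classify-outside (d ∷ []) I 0∷τ↭ τ-pos _ _ I↗ D<I =
  here (0∷↗≡ascending τ-pos (APP.++⁺ ([] ∷ []) I↗ D<I) 0∷τ↭)
classify-outside D@(_ ∷ _ ∷ _) [] 0∷τ↭ _ _ D↘ _ _ =
  there (here (0∷↘≡descending (APP.++⁺ D↘ [] (All.tabulate (λ _ → []))) 0∷τ↭))
classify-outside D@(_ ∷ _ ∷ _) (m ∷ []) 0∷τ↭ _ _ D↘ _ D<m =
  there (there (here (0∷↘∷ʳmax≡minDescendingMax (All.map (λ { (d<m ∷ []) → d<m }) D<m) D↘ 0∷τ↭)))
classify-outside (d₁ ∷ d₂ ∷ D) (i₁ ∷ i₂ ∷ I) _ _ ¬1342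
                 ((d₂<d₁ ∷ _) ∷ _) ((i₁<i₂ ∷ _) ∷ _) ((d₁<i₁ ∷ _) ∷ _) =
  ⊥-elim (¬1342 (d₂ ∷ i₁ ∷ i₂ ∷ [] , d₁ ∷ [] ,
                 0 ∷ʳ (refl ∷ refl ∷ ++⁺ˡ D (refl ∷ refl ∷ []⊆-universal I)) ,
                 OrderIso-relabel (chain-mono d₂<d₁ d₁<i₁ i₁<i₂)))

ΠA ΠB : List (List ℕ)
ΠA = p1243 ∷ p1324 ∷ p1342 ∷ []
ΠB = p1243 ∷ p1342 ∷ p1423 ∷ []

Classifies : List (List ℕ) → (ℕ → List ℕ) → Set
Classifies Π third = ∀ n τ → IsPerm (suc n) (0 ∷ τ) → Avoids Π (0 ∷ τ) →
                     (0 ∷ τ) ∈ candidates third (suc n)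

classifiesA : Classifies ΠA minMaxAscending
classifiesA n τ 0∷τ↭ (¬1243 ∷ ¬1324 ∷ ¬1342 ∷ []) with IsPerm-0∷⇒positive×unique 0∷τ↭
... | τ-pos , τ-unique
  with valleyShape-below τ τ-unique (ascentsPersist τ-pos τ-unique ¬1243 ¬1342)
                                    (descentsStayBelow τ-pos τ-unique ¬1324)
... | D , I , refl , D↘ , I↗ , D>I = classify-below D I 0∷τ↭ τ-pos ¬1243 D↘ I↗ D>I

classifiesB : Classifies ΠB minDescendingMax
classifiesB n τ 0∷τ↭ (¬1243 ∷ ¬1342 ∷ ¬1423 ∷ []) with IsPerm-0∷⇒positive×unique 0∷τ↭
... | τ-pos , τ-unique
  with valleyShape-outside τ τ-unique (ascentsPersist τ-pos τ-unique ¬1243 ¬1342)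
                                      (descentsStayOutside τ-pos τ-unique ¬1423)
... | D , I , refl , D↘ , I↗ , D<I = classify-outside D I 0∷τ↭ τ-pos ¬1342 D↘ I↗ D<I

candidates-complete : ∀ {Π} third → Classifies Π third → ∀ n σ → IsPerm n σ → CycAvoidsAll Π σ →
                      ∃[ ρ ] (ρ ∈ candidates third n × RotEq ρ σ)
candidates-complete _ _ zero σ σ↭ _ with ↭-empty-inv σ↭
... | refl = [] , here refl , 0 , z≤n , refl
candidates-complete _ classifies (suc n) σ σ↭ σ-avoids with rotate-min-first σ↭
... | τ , rot , 0∷τ↭ =
  0 ∷ τ , classifies n τ 0∷τ↭ (Avoids-resp-RotEq⁻ rot (CycAvoidsAll⇒Avoids σ-avoids)) , rot

NumAv-intro : ∀ {Π n} L C → All (λ ρ → IsPerm n ρ × CycAvoidsAll Π ρ) L →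
              AllPairs (λ ρ ρ′ → ¬ RotEq ρ ρ′) L → All (_∈ L) C →
              (∀ σ → IsPerm n σ → CycAvoidsAll Π σ → ∃[ ρ ] (ρ ∈ C × RotEq ρ σ)) →
              NumAv Π n (length L)
NumAv-intro L C valid distinct C⊆L complete = L , refl , valid , distinct , λ σ σ↭ σ-avoids →
  let ρ , ρ∈C , rot = complete σ σ↭ σ-avoids in ρ , All.lookup C⊆L ρ∈C , rot

count : ℕ → ℕ
count 3                         = 2
count (suc (suc (suc (suc _)))) = 3
count _                         = 1

count-≥4 : ∀ {n} → 4 ≤ n → count n ≡ 3
count-≥4 (s≤s (s≤s (s≤s (s≤s _)))) = refl

module Count (Π : List (List ℕ)) (third : ℕ → List ℕ) (classifies : Classifies Π third)
  (ascending-ok : ∀ n → Avoids Π (ascending n)) (descending-ok : ∀ n → Avoids Π (descending n))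
  (third-perm : ∀ n → IsPerm n (third n)) (third-ok : ∀ n → Avoids Π (third n))
  (third-small : ∀ n → n < 3 → third n ≡ ascending n)
  (third-3 : third 3 ∈ ascending 3 ∷ descending 3 ∷ [])
  (third-separated : ∀ k → ¬ RotEq (ascending (4 + k)) (third (4 + k))
                         × ¬ RotEq (descending (4 + k)) (third (4 + k)))
  where

  valid : ∀ {rep : ℕ → List ℕ} → (∀ n → IsPerm n (rep n)) → (∀ n → Avoids Π (rep n)) →
          ∀ n → IsPerm n (rep n) × CycAvoidsAll Π (rep n)
  valid rep-perm rep-ok n = rep-perm n , Avoids⇒CycAvoidsAll (rep-ok n)

  numAv-small : ∀ n → n < 3 → NumAv Π n 1
  numAv-small n n<3 = NumAv-intro (ascending n ∷ []) (candidates third n)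
    (valid ascending-perm ascending-ok n ∷ []) ([] ∷ [])
    (here refl ∷ here (descending-small n<3) ∷ here (third-small n n<3) ∷ [])
    (candidates-complete third classifies n)
    where
    descending-small : ∀ {n} → n < 3 → descending n ≡ ascending n
    descending-small {0} _ = refl
    descending-small {1} _ = refl
    descending-small {2} _ = refl
    descending-small {suc (suc (suc _))} (s<s (s<s (s<s ())))

  numAv : ∀ n → NumAv Π n (count n)
  numAv 0 = numAv-small 0 z<s
  numAv 1 = numAv-small 1 (s<s z<s)
  numAv 2 = numAv-small 2 (s<s (s<s z<s))
  numAv 3 = NumAv-intro (ascending 3 ∷ descending 3 ∷ []) (candidates third 3)
    (valid ascending-perm ascending-ok 3 ∷ valid descending-perm descending-ok 3 ∷ [])
    ((ascending3≁descending3 ∷ []) ∷ [] ∷ [])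
    (here refl ∷ there (here refl) ∷ third-3 ∷ [])
    (candidates-complete third classifies 3)
  numAv n@(suc (suc (suc (suc k)))) = NumAv-intro (candidates third n) (candidates third n)
    (valid ascending-perm ascending-ok n ∷ valid descending-perm descending-ok n ∷
     valid third-perm third-ok n ∷ [])
    ((ascending≁descending k ∷ proj₁ (third-separated k) ∷ []) ∷
     (proj₂ (third-separated k) ∷ []) ∷ [] ∷ [])
    (All.tabulate id)
    (candidates-complete third classifies n)

module CountA = Count ΠA minMaxAscending classifiesA
  (λ n → ascending-avoids n _) (λ n → descending-avoids n _)
  minMaxAscending-perm (λ n → minMaxAscending-avoids n _)
  minMaxAscending-small (there (here refl)) minMaxAscending-separated

module CountB = Count ΠB minDescendingMax classifiesB
  (λ n → ascending-avoids n _) (λ n → descending-avoids n _)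
  minDescendingMax-perm (λ n → minDescendingMax-avoids n _)
  minDescendingMax-small (here refl) minDescendingMax-separated

mainTheorem13 :
    (∀ (n : ℕ) → ∃[ k ] ( NumAv (p1243 ∷ p1324 ∷ p1342 ∷ []) n k
                        × NumAv (p1243 ∷ p1342 ∷ p1423 ∷ []) n k ))
    × (∀ (n : ℕ) → 4 ≤ n → NumAv (p1243 ∷ p1324 ∷ p1342 ∷ []) n 3)
mainTheorem13 =
  (λ n → count n , CountA.numAv n , CountB.numAv n) ,
  (λ n 4≤n → subst (NumAv ΠA n) (count-≥4 4≤n) (CountA.numAv n))
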